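{- Let $\mathcal{T}$ be a tangle of order $k$ in a $k$-entangled connectivity system $K=(E,\lambda)$. Then a set $X\in\mathcal S_k(K)$ is weakly $\lambda(X)$-branched if and only if $X\in\mathcal{T}$.
   Context: A connectivity system is a pair $(E,\lambda)$, $E$ finite, $\lambda$ a non-negative integer-valued function on subsets of $E$ with $\lambda(X)=\lambda(E\setminus X)$ and $\lambda(X\cap Y)+\lambda(X\cup Y)\le\lambda(X)+\lambda(Y)$. $\mathcal S_k(K)$ is the set of $X\subseteq E$ with $\lambda(X)<k$. A tangle of order $k$ in $K$ is a set $\mathcal{T}\subseteq\mathcal S_k(K)$ such that for each $A\in\mathcal S_k(K)$ exactly one of $A$, $E\setminus A$ lies in $\mathcal{T}$, there are no $T_1,T_2,T_3\in\mathcal{T}$ with $T_1\cup T_2\cup T_3=E$, and no set in $\mathcal{T}$ has size $|E|-1$. $K$ is $k$-entangled if for each $t\le k$ it has at most one tangle of order $t$. A cubic tree is a tree whose vertices have degree 1 or 3 (degree-1 vertices are leaves). A partial branch-decomposition of $K$ is a pair $(T,f)$ with $T$ a cubic tree and $f$ a map from $E$ to the leaves of $T$; a leaf $v$ displays $f^{ -1}(v)$; for an edge $e$ of $T$, the width of $e$ is $\lambda(A_e)$ where $A_e$ is the set of elements mapped into one component of $T-e$, and the width of $(T,f)$ is the maximum edge width. A set $X\subseteq E$ is weakly $t$-branched if $\lambda(X)\le t$ and there is a partial branch-decomposition of $K$ of width at most $t$ in which each leaf displays either a subset of $E\setminus X$ or a singleton. -}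

module Defs where

open import Data.Nat using (ℕ; suc; _≤_; _<_; _+_)
open import Data.Bool using (Bool; true; false)
open import Data.Fin using (Fin)
open import Data.Fin.Subset using (Subset; _∪_; _∩_; ∁; ⊤; ∣_∣; _∉_)
open import Data.Vec using (tabulate)
open import Data.Maybe using (Maybe; just; nothing; maybe)
open import Data.Product using (Σ; _×_; ∃)
open import Data.Sum using (_⊎_)
open import Data.Empty using (⊥)
open import Relation.Nullary using (¬_)
open import Relation.Binary.PropositionalEquality using (_≡_)
open import Function.Bundles using (_⇔_)

record ConnSys : Set where
  field
    n      : ℕ
    conn   : Subset n → ℕ
    symm   : ∀ X → conn X ≡ conn (∁ X)
    submod : ∀ X Y → conn (X ∩ Y) + conn (X ∪ Y) ≤ conn X + conn Y

module _ (K : ConnSys) where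
  open ConnSys K

  InS : ℕ → Subset n → Set
  InS k X = conn X < k

  record IsTangle (k : ℕ) (𝒯 : Subset n → Set) : Set where
    field
      sub      : ∀ X → 𝒯 X → InS k X
      oneOf    : ∀ A → InS k A → 𝒯 A ⊎ 𝒯 (∁ A)
      notBoth  : ∀ A → InS k A → ¬ (𝒯 A × 𝒯 (∁ A))
      noCover  : ∀ T₁ T₂ T₃ → 𝒯 T₁ → 𝒯 T₂ → 𝒯 T₃ → ¬ (T₁ ∪ T₂ ∪ T₃ ≡ ⊤)
      noBig    : ∀ X → 𝒯 X → ¬ (suc ∣ X ∣ ≡ n)

  Entangled : ℕ → Set₁
  Entangled k = ∀ t → t ≤ k → (𝒯₁ 𝒯₂ : Subset n → Set) →
    IsTangle t 𝒯₁ → IsTangle t 𝒯₂ → ∀ X → 𝒯₁ X ⇔ 𝒯₂ X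

-- A cubic tree (all degrees 1 or 3, hence ≥ 2 vertices) is
-- represented by rooting it at one of its leaves: a root leaf attached to
-- a full binary tree.  Every cubic tree arises this way.

data BTree : Set where
  leaf : BTree
  node : BTree → BTree → BTree

data LeafPos : BTree → Set where
  here  : LeafPos leaf
  left  : ∀ {l r} → LeafPos l → LeafPos (node l r)
  right : ∀ {l r} → LeafPos r → LeafPos (node l r)

-- vertices of a binary tree; each vertex p determines the edge from p to
-- its parent (the parent of the binary tree's root is the root leaf),
-- and this gives all edges of the cubic tree exactly once.
data NodePos : BTree → Set where
  here : ∀ {t} → NodePos t
  inl  : ∀ {l r} → NodePos l → NodePos (node l r)
  inr  : ∀ {l r} → NodePos r → NodePos (node l r)

below : ∀ {t} → LeafPos t → NodePos t → Bool
below a         here    = true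
below (left a)  (inl p) = below a p
below (right a) (inr p) = below a p
below (left a)  (inr p) = false
below (right a) (inl p) = false

-- leaves of the cubic tree: nothing = the root leaf
CLeaf : BTree → Set
CLeaf t = Maybe (LeafPos t)

module _ (K : ConnSys) where
  open ConnSys K

  record PBD : Set where
    field
      tree : BTree
      f    : Fin n → CLeaf tree

    -- A_e for the edge e determined by vertex p: elements mapped into the
    -- component of T - e containing p
    side : NodePos tree → Subset n
    side p = tabulate (λ x → maybe (λ a → below a p) false (f x))

    WidthLE : ℕ → Set
    WidthLE t = ∀ p → conn (side p) ≤ t

    DisplaysSubsetOf : CLeaf tree → Subset n → Set
    DisplaysSubsetOf v Y = ∀ x → f x ≡ v → x Data.Fin.Subset.∈ Y

    DisplaysSingleton : CLeaf tree → Set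
    DisplaysSingleton v = ∃ λ y → ∀ x → (f x ≡ v) ⇔ (x ≡ y)

  WeaklyBranched : ℕ → Subset n → Set
  WeaklyBranched t X = conn X ≤ t × Σ PBD λ D →
    PBD.WidthLE D t ×
    (∀ v → PBD.DisplaysSubsetOf D v (∁ X) ⊎ PBD.DisplaysSingleton D v)

-- If X ∉ 𝒯 then ∁ X ∈ 𝒯, and every leaf of a decomposition witnessing that X is weakly
-- λ(X)-branched displays a subset of ∁ X or a singleton, hence a member of 𝒯.  Since no three
-- members of 𝒯 cover E, induction from the leaves puts the side of every edge facing away from
-- the root leaf in 𝒯; at the root edge a set and its complement would then both lie in 𝒯.
--
-- Conversely let t = λ(X) and apply the duality between tangles of order t + 1 and
-- decompositions of width t to the family of subsets of ∁ X of order at most t.  A tangle of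
-- order t + 1 containing ∁ X would, by entanglement, be the truncation of 𝒯, which contains X;
-- so there is a decomposition of width t whose leaves display subsets of ∁ X or singletons.
-- The duality is proved by induction on the number of sets of order at most t that the family
-- leaves undecided: add a minimal-order undecided set A, respectively ∁ A, to the family, and
-- graft the two resulting decompositions at leaves that fail for the original family.
-- Submodularity and the minimality of λ(A) keep the grafted decomposition of width t.

module Submission where

open import Defs
open import Data.Nat using (ℕ; zero; suc; _≤_; _<_; _+_; _∸_; z≤n; s≤s; _≤?_; _<?_; _≟_)
open import Data.Nat.Properties
  using (≤-refl; ≤-reflexive; ≤-trans; ≤-pred; <⇒≤; <⇒≱; ≰⇒>; ≮⇒≥; ≤-<-trans; <-≤-trans; suc-injective;
         +-mono-≤; +-monoʳ-≤; +-mono-<; +-mono-<-≤; +-mono-≤-<; +-cancelʳ-≤; m+n∸n≡m;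
         ⌊n/2⌋-mono; n≡⌊n+n/2⌋; module ≤-Reasoning)
open import Data.Nat.Induction using (<-wellFounded)
open import Induction.WellFounded using (Acc; acc)
open import Data.Bool using (Bool; true; false; not; _∧_; _∨_; _xor_; if_then_else_)
open import Data.Bool.Properties using (∧-zeroʳ; ∧-identityʳ; xor-assoc; not-distribˡ-xor; not-distribʳ-xor)
import Data.Bool.Properties as Bool
open import Data.Maybe using (just; nothing; maybe)
import Data.Maybe as Maybe
import Data.Maybe.Properties as Maybe
open import Data.Fin using (Fin; zero; suc)
open import Data.Fin.Subset using (Subset; inside; outside; _∈_; _∉_; _⊆_; _∪_; _∩_; ∁; ⊤; ⊥; ∣_∣; ⁅_⁆)
open import Data.Fin.Subset.Properties
  using (_∈?_; _⊆?_; anySubset?; ∉⊥; x∈p∩q⁺; x∈p∩q⁻; x∈p∪q⁺; x∈∁p⇒x∉p; x∉p⇒x∈∁p; x∈⁅x⁆; x∈⁅y⁆⇒x≡y;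
         ⊆-antisym; ⊆-reflexive; ⊆-trans; ⊆-min; ⊆⊤; p⊆q⇒∁p⊇∁q; p∩q⊆p; ∣∁p∣≡n∸∣p∣; ∣⁅x⁆∣≡1;
         ∪-assoc; ∪-comm; ∪-idem; ∪-distribʳ-∩; ∪-inverseˡ; p∪∁p≡⊤;
         ∩-assoc; ∩-comm; ∩-inverseˡ; ∩-inverseʳ; ∩-zeroʳ; ∩-identityʳ; ∪-∩-booleanAlgebra)
import Algebra.Lattice.Properties.BooleanAlgebra as BooleanAlgebraProperties
open import Data.Vec using ([]; _∷_; lookup; tabulate)
open import Data.Vec.Properties
  using (lookup∘tabulate; tabulate∘lookup; tabulate-cong; tabulate-∘; lookup-map; lookup-zipWith;
         lookup-replicate; []=⇒lookup; lookup⇒[]=; ≡-dec)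
open import Data.Product using (Σ; _×_; _,_; proj₁; proj₂; ∃)
open import Data.Sum using (_⊎_; inj₁; inj₂)
open import Data.Empty using (⊥-elim)
open import Relation.Nullary using (¬_; Dec; yes; no; does; contradiction)
open import Relation.Nullary.Decidable using (map′; dec-true; _×-dec_; _⊎-dec_; ¬?)
open import Relation.Unary using (Decidable)
open import Relation.Binary.Definitions using (DecidableEquality)
open import Relation.Binary.PropositionalEquality
  using (_≡_; _≢_; refl; sym; trans; cong; cong₂; subst; subst₂; module ≡-Reasoning)
open import Function using (_∘_)
open import Function.Bundles using (_⇔_; mk⇔; Equivalence)

module _ {n : ℕ} where
  open BooleanAlgebraProperties (∪-∩-booleanAlgebra n) public
    using () renaming (¬-involutive to ∁-involutive; deMorgan₂ to ∁-∪; ¬⊤≈⊥ to ∁⊤≡⊥)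

  ∈-tabulate : {g : Fin n → Bool} {x : Fin n} → x ∈ tabulate g ⇔ g x ≡ true
  ∈-tabulate {g} {x} = mk⇔
    (λ x∈ → trans (sym (lookup∘tabulate g x)) ([]=⇒lookup x∈))
    (λ gx → lookup⇒[]= x (tabulate g) (trans (lookup∘tabulate g x) gx))

  infix 4 _≟ˢ_
  _≟ˢ_ : DecidableEquality (Subset n)
  _≟ˢ_ = ≡-dec Bool._≟_

  ∈⇔lookup : ∀ {p : Subset n} {x} → x ∈ p ⇔ lookup p x ≡ true
  ∈⇔lookup {p} {x} = mk⇔ []=⇒lookup (lookup⇒[]= x p)

  subset-ext : {p q : Subset n} → (∀ x → lookup p x ≡ lookup q x) → p ≡ q
  subset-ext {p} {q} eq = trans (sym (tabulate∘lookup p)) (trans (tabulate-cong eq) (tabulate∘lookup q))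

  lookup-∪ : ∀ (p q : Subset n) x → lookup (p ∪ q) x ≡ (lookup p x ∨ lookup q x)
  lookup-∪ p q x = lookup-zipWith _∨_ x p q

  lookup-∩ : ∀ (p q : Subset n) x → lookup (p ∩ q) x ≡ (lookup p x ∧ lookup q x)
  lookup-∩ p q x = lookup-zipWith _∧_ x p q

  lookup-∁ : ∀ (p : Subset n) x → lookup (∁ p) x ≡ not (lookup p x)
  lookup-∁ p x = lookup-map x not p

  lookup-disjoint : ∀ {p q : Subset n} → p ∩ q ≡ ⊥ → ∀ x → (lookup p x ∧ lookup q x) ≡ false
  lookup-disjoint {p} {q} p∩q≡⊥ x =
    trans (sym (lookup-∩ p q x)) (trans (cong (λ r → lookup r x) p∩q≡⊥) (lookup-replicate x false))

  lookup-cover : ∀ {p q r : Subset n} → p ∪ q ∪ r ≡ ⊤ → ∀ x → (lookup p x ∨ lookup q x ∨ lookup r x) ≡ true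
  lookup-cover {p} {q} {r} covers x = begin
    lookup p x ∨ lookup q x ∨ lookup r x ≡⟨ cong (lookup p x ∨_) (lookup-∪ q r x) ⟨
    lookup p x ∨ lookup (q ∪ r) x       ≡⟨ lookup-∪ p (q ∪ r) x ⟨
    lookup (p ∪ q ∪ r) x                ≡⟨ cong (λ s → lookup s x) covers ⟩
    lookup ⊤ x                          ≡⟨ lookup-replicate x true ⟩
    true                                ∎
    where open ≡-Reasoning

  ∩≡⊥-⊆ : ∀ {p q p′ q′ : Subset n} → p ∩ q ≡ ⊥ → p′ ⊆ p → q′ ⊆ q → p′ ∩ q′ ≡ ⊥
  ∩≡⊥-⊆ {p} {q} {p′} {q′} p∩q≡⊥ p′⊆p q′⊆q = ⊆-antisym
    (λ x∈ → let (x∈p′ , x∈q′) = x∈p∩q⁻ p′ q′ x∈ in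
            subst (_ ∈_) p∩q≡⊥ (x∈p∩q⁺ (p′⊆p x∈p′ , q′⊆q x∈q′)))
    (λ x∈⊥ → ⊥-elim (∉⊥ x∈⊥))

  ⊆⇒∪∁≡⊤ : {F Y : Subset n} → F ⊆ Y → Y ∪ ∁ F ≡ ⊤
  ⊆⇒∪∁≡⊤ {F} {Y} F⊆Y = ⊆-antisym ⊆⊤ λ {x} _ → x∈p∪q⁺ (in-Y-or-∁F (x ∈? F))
    where
    in-Y-or-∁F : ∀ {x} → Dec (x ∈ F) → x ∈ Y ⊎ x ∈ ∁ F
    in-Y-or-∁F (yes x∈F) = inj₁ (F⊆Y x∈F)
    in-Y-or-∁F (no x∉F)  = inj₂ (x∉p⇒x∈∁p x∉F)

∣p∣≡0⇒p≡⊥ : ∀ {n} (p : Subset n) → ∣ p ∣ ≡ 0 → p ≡ ⊥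
∣p∣≡0⇒p≡⊥ []            _  = refl
∣p∣≡0⇒p≡⊥ (outside ∷ p) eq = cong (outside ∷_) (∣p∣≡0⇒p≡⊥ p eq)

∣p∣≡1⇒p≡⁅x⁆ : ∀ {n} (p : Subset n) → ∣ p ∣ ≡ 1 → ∃ λ x → p ≡ ⁅ x ⁆
∣p∣≡1⇒p≡⁅x⁆ (inside ∷ p)  eq = zero , cong (inside ∷_) (∣p∣≡0⇒p≡⊥ p (suc-injective eq))
∣p∣≡1⇒p≡⁅x⁆ (outside ∷ p) eq with ∣p∣≡1⇒p≡⁅x⁆ p eq
... | x , refl = suc x , refl

suc∣p∣≡n⇒∁p≡⁅x⁆ : ∀ {n} (p : Subset n) → suc ∣ p ∣ ≡ n → ∃ λ x → ∁ p ≡ ⁅ x ⁆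
suc∣p∣≡n⇒∁p≡⁅x⁆ {n} p eq = ∣p∣≡1⇒p≡⁅x⁆ (∁ p) (begin
  ∣ ∁ p ∣          ≡⟨ ∣∁p∣≡n∸∣p∣ p ⟩
  n ∸ ∣ p ∣        ≡⟨ cong (_∸ ∣ p ∣) eq ⟨
  suc ∣ p ∣ ∸ ∣ p ∣ ≡⟨ m+n∸n≡m 1 ∣ p ∣ ⟩
  1                ∎)
  where open ≡-Reasoning

suc-∣∁⁅⁆∣ : ∀ {n} (y : Fin n) → suc ∣ ∁ ⁅ y ⁆ ∣ ≡ n
suc-∣∁⁅⁆∣ {suc m} y = cong suc (trans (∣∁p∣≡n∸∣p∣ ⁅ y ⁆) (cong (suc m ∸_) (∣⁅x⁆∣≡1 y)))

true⇒witness : ∀ {A : Set} (a? : Dec A) → does a? ≡ true → A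
true⇒witness (yes a) _ = a

left-injective : ∀ {l r} {a b : LeafPos l} → left {l} {r} a ≡ left b → a ≡ b
left-injective refl = refl

right-injective : ∀ {l r} {a b : LeafPos r} → right {l} {r} a ≡ right b → a ≡ b
right-injective refl = refl

_≟ᴸ_ : ∀ {t} → DecidableEquality (LeafPos t)
here    ≟ᴸ here    = yes refl
left a  ≟ᴸ left b  = map′ (cong left) left-injective (a ≟ᴸ b)
right a ≟ᴸ right b = map′ (cong right) right-injective (a ≟ᴸ b)
left _  ≟ᴸ right _ = no λ ()
right _ ≟ᴸ left _  = no λ ()

_≟ᶜ_ : ∀ {t} → DecidableEquality (CLeaf t)
_≟ᶜ_ = Maybe.≡-dec _≟ᴸ_

vertexOf : ∀ {t} → LeafPos t → NodePos t
vertexOf here      = here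
vertexOf (left a)  = inl (vertexOf a)
vertexOf (right a) = inr (vertexOf a)

below-vertexOf : ∀ {t} (b a : LeafPos t) → below b (vertexOf a) ≡ does (b ≟ᴸ a)
below-vertexOf here      here      = refl
below-vertexOf (left b)  (left a)  = below-vertexOf b a
below-vertexOf (right b) (right a) = below-vertexOf b a
below-vertexOf (left b)  (right a) = refl
below-vertexOf (right b) (left a)  = refl

below-here : ∀ {t} (a : LeafPos t) → below a here ≡ true
below-here here      = refl
below-here (left a)  = refl
below-here (right a) = refl

all-leaves-or-counterexample : ∀ {t} {G B : LeafPos t → Set} → (∀ a → G a ⊎ B a) → (∀ a → G a) ⊎ ∃ B
all-leaves-or-counterexample {leaf} classify with classify here
... | inj₁ good = inj₁ λ { here → good }
... | inj₂ bad  = inj₂ (here , bad)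
all-leaves-or-counterexample {node l r} classify
  with all-leaves-or-counterexample (classify ∘ left) | all-leaves-or-counterexample (classify ∘ right)
... | inj₂ (a , bad) | _              = inj₂ (left a , bad)
... | inj₁ _         | inj₂ (a , bad) = inj₂ (right a , bad)
... | inj₁ goodˡ     | inj₁ goodʳ     = inj₁ λ { (left a) → goodˡ a ; (right a) → goodʳ a }

all-or-counterexample : ∀ {t} {G B : CLeaf t → Set} → (∀ v → G v ⊎ B v) → (∀ v → G v) ⊎ ∃ B
all-or-counterexample classify with classify nothing | all-leaves-or-counterexample (classify ∘ just)
... | inj₂ bad  | _              = inj₂ (nothing , bad)
... | inj₁ _    | inj₂ (a , bad) = inj₂ (just a , bad)
... | inj₁ good | inj₁ goods     = inj₁ λ { nothing → good ; (just a) → goods a }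

belowᶜ : ∀ {t} → CLeaf t → NodePos t → Bool
belowᶜ v p = maybe (λ a → below a p) false v

module _ {n : ℕ} {t : BTree} (f : Fin n → CLeaf t) where

  -- Definitionally equal to PBD.side.
  side : NodePos t → Subset n
  side p = tabulate (λ x → belowᶜ (f x) p)

  fibre : CLeaf t → Subset n
  fibre v = tabulate (λ x → does (f x ≟ᶜ v))

  ∈-side : ∀ {x p} → x ∈ side p ⇔ belowᶜ (f x) p ≡ true
  ∈-side = ∈-tabulate

  ∈-fibre : ∀ {x v} → x ∈ fibre v ⇔ f x ≡ v
  ∈-fibre {x} {v} = mk⇔
    (λ x∈ → true⇒witness (f x ≟ᶜ v) (Equivalence.to ∈-tabulate x∈))
    (λ fx≡v → Equivalence.from ∈-tabulate (dec-true (f x ≟ᶜ v) fx≡v))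

  fibre-just : ∀ a → fibre (just a) ≡ side (vertexOf a)
  fibre-just a = tabulate-cong λ x → lemma (f x)
    where
    lemma : ∀ v → does (v ≟ᶜ just a) ≡ belowᶜ v (vertexOf a)
    lemma nothing  = refl
    lemma (just b) = sym (below-vertexOf b a)

  fibre-nothing : fibre nothing ≡ ∁ (side here)
  fibre-nothing = trans (tabulate-cong λ x → lemma (f x)) (tabulate-∘ not _)
    where
    lemma : ∀ v → does (v ≟ᶜ nothing) ≡ not (belowᶜ v here)
    lemma nothing  = refl
    lemma (just b) = cong not (sym (below-here b))

  fibre-nothing⊆∁side : ∀ p → fibre nothing ⊆ ∁ (side p)
  fibre-nothing⊆∁side p x∈root = x∉p⇒x∈∁p λ x∈side →
    contradiction (trans (sym (Equivalence.to (∈-side {p = p}) x∈side))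
                         (cong (λ v → belowᶜ v p) (Equivalence.to ∈-fibre x∈root))) λ ()

  fibre⊆⇔ : ∀ {v Y} → fibre v ⊆ Y ⇔ (∀ x → f x ≡ v → x ∈ Y)
  fibre⊆⇔ = mk⇔ (λ F⊆Y x fx≡v → F⊆Y (Equivalence.from ∈-fibre fx≡v))
                (λ displays {x} x∈F → displays x (Equivalence.to ∈-fibre x∈F))

  fibre≡⁅⁆⇔ : ∀ {v y} → fibre v ≡ ⁅ y ⁆ ⇔ (∀ x → (f x ≡ v) ⇔ (x ≡ y))
  fibre≡⁅⁆⇔ {v} {y} = mk⇔ to from
    where
    to : fibre v ≡ ⁅ y ⁆ → ∀ x → (f x ≡ v) ⇔ (x ≡ y)
    to F≡y x = mk⇔
      (λ fx≡v → x∈⁅y⁆⇒x≡y y (subst (x ∈_) F≡y (Equivalence.from ∈-fibre fx≡v)))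
      (λ { refl → Equivalence.to ∈-fibre (subst (x ∈_) (sym F≡y) (x∈⁅x⁆ x)) })
    from : (∀ x → (f x ≡ v) ⇔ (x ≡ y)) → fibre v ≡ ⁅ y ⁆
    from singleton = ⊆-antisym
      (λ {x} x∈F → subst (_∈ ⁅ y ⁆) (sym (Equivalence.to (singleton x) (Equivalence.to ∈-fibre x∈F))) (x∈⁅x⁆ y))
      (λ {x} x∈y → Equivalence.from ∈-fibre (Equivalence.from (singleton x) (x∈⁅y⁆⇒x≡y y x∈y)))

restrictˡ : ∀ {l r} → CLeaf (node l r) → CLeaf l
restrictˡ nothing          = nothing
restrictˡ (just (left a))  = just a
restrictˡ (just (right _)) = nothing

restrictʳ : ∀ {l r} → CLeaf (node l r) → CLeaf r
restrictʳ nothing          = nothing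
restrictʳ (just (left _))  = nothing
restrictʳ (just (right a)) = just a

module _ {n : ℕ} {l r : BTree} (f : Fin n → CLeaf (node l r)) where

  side-restrictˡ : ∀ p → side (restrictˡ ∘ f) p ≡ side f (inl p)
  side-restrictˡ p = tabulate-cong λ x → lemma (f x)
    where
    lemma : ∀ v → belowᶜ (restrictˡ v) p ≡ belowᶜ v (inl p)
    lemma nothing          = refl
    lemma (just (left a))  = refl
    lemma (just (right a)) = refl

  side-restrictʳ : ∀ p → side (restrictʳ ∘ f) p ≡ side f (inr p)
  side-restrictʳ p = tabulate-cong λ x → lemma (f x)
    where
    lemma : ∀ v → belowᶜ (restrictʳ v) p ≡ belowᶜ v (inr p)
    lemma nothing          = refl
    lemma (just (left a))  = refl
    lemma (just (right a)) = refl

  fibre-restrictˡ : ∀ a → fibre (restrictˡ ∘ f) (just a) ≡ fibre f (just (left a))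
  fibre-restrictˡ a = begin
    fibre (restrictˡ ∘ f) (just a)   ≡⟨ fibre-just (restrictˡ ∘ f) a ⟩
    side (restrictˡ ∘ f) (vertexOf a) ≡⟨ side-restrictˡ (vertexOf a) ⟩
    side f (vertexOf (left a))        ≡⟨ fibre-just f (left a) ⟨
    fibre f (just (left a))           ∎
    where open ≡-Reasoning

  fibre-restrictʳ : ∀ a → fibre (restrictʳ ∘ f) (just a) ≡ fibre f (just (right a))
  fibre-restrictʳ a = begin
    fibre (restrictʳ ∘ f) (just a)   ≡⟨ fibre-just (restrictʳ ∘ f) a ⟩
    side (restrictʳ ∘ f) (vertexOf a) ≡⟨ side-restrictʳ (vertexOf a) ⟩
    side f (vertexOf (right a))       ≡⟨ fibre-just f (right a) ⟨
    fibre f (just (right a))          ∎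
    where open ≡-Reasoning

  side-here-∪ : side f here ≡ side f (inl here) ∪ side f (inr here)
  side-here-∪ = subset-ext λ x → begin
    lookup (side f here) x                                      ≡⟨ lookup∘tabulate _ x ⟩
    belowᶜ (f x) here                                           ≡⟨ lemma (f x) ⟩
    belowᶜ (f x) (inl here) ∨ belowᶜ (f x) (inr here)           ≡⟨ cong₂ _∨_ (lookup∘tabulate _ x) (lookup∘tabulate _ x) ⟨
    lookup (side f (inl here)) x ∨ lookup (side f (inr here)) x ≡⟨ lookup-∪ (side f (inl here)) (side f (inr here)) x ⟨
    lookup (side f (inl here) ∪ side f (inr here)) x            ∎
    where
    open ≡-Reasoning
    lemma : ∀ v → belowᶜ v here ≡ (belowᶜ v (inl here) ∨ belowᶜ v (inr here))
    lemma nothing          = refl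
    lemma (just (left a))  = cong (_∨ false) (below-here a)
    lemma (just (right a)) = below-here a

-- Rerooting a cubic tree at one of its leaves

-- hang t v s: t re-hung from its leaf v, with s grafted where the root leaf of t was.
hang : (t : BTree) → LeafPos t → BTree → BTree
hang leaf       here      s = s
hang (node l r) (left v)  s = hang l v (node r s)
hang (node l r) (right v) s = hang r v (node l s)

Pos : BTree → BTree → Set
Pos t s = LeafPos t ⊎ LeafPos s

module _ {l r s : BTree} where

  shiftˡ : Pos (node l r) s → Pos l (node r s)
  shiftˡ (inj₁ (left a))  = inj₁ a
  shiftˡ (inj₁ (right a)) = inj₂ (left a)
  shiftˡ (inj₂ b)         = inj₂ (right b)

  unshiftˡ : Pos l (node r s) → Pos (node l r) s
  unshiftˡ (inj₁ a)         = inj₁ (left a)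
  unshiftˡ (inj₂ (left a))  = inj₁ (right a)
  unshiftˡ (inj₂ (right b)) = inj₂ b

  shiftʳ : Pos (node l r) s → Pos r (node l s)
  shiftʳ (inj₁ (left a))  = inj₂ (left a)
  shiftʳ (inj₁ (right a)) = inj₁ a
  shiftʳ (inj₂ b)         = inj₂ (right b)

  unshiftʳ : Pos r (node l s) → Pos (node l r) s
  unshiftʳ (inj₁ a)         = inj₁ (right a)
  unshiftʳ (inj₂ (left a))  = inj₁ (left a)
  unshiftʳ (inj₂ (right b)) = inj₂ b

  unshiftˡ-shiftˡ : ∀ z → unshiftˡ (shiftˡ z) ≡ z
  unshiftˡ-shiftˡ (inj₁ (left a))  = refl
  unshiftˡ-shiftˡ (inj₁ (right a)) = refl
  unshiftˡ-shiftˡ (inj₂ b)         = refl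

  shiftˡ-unshiftˡ : ∀ z → shiftˡ (unshiftˡ z) ≡ z
  shiftˡ-unshiftˡ (inj₁ a)         = refl
  shiftˡ-unshiftˡ (inj₂ (left a))  = refl
  shiftˡ-unshiftˡ (inj₂ (right b)) = refl

  unshiftʳ-shiftʳ : ∀ z → unshiftʳ (shiftʳ z) ≡ z
  unshiftʳ-shiftʳ (inj₁ (left a))  = refl
  unshiftʳ-shiftʳ (inj₁ (right a)) = refl
  unshiftʳ-shiftʳ (inj₂ b)         = refl

  shiftʳ-unshiftʳ : ∀ z → shiftʳ (unshiftʳ z) ≡ z
  shiftʳ-unshiftʳ (inj₁ a)         = refl
  shiftʳ-unshiftʳ (inj₂ (left a))  = refl
  shiftʳ-unshiftʳ (inj₂ (right b)) = refl

relabel : (t : BTree) (v : LeafPos t) (s : BTree) → Pos t s → CLeaf (hang t v s)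
relabel leaf       here      s (inj₁ here) = nothing
relabel leaf       here      s (inj₂ b)    = just b
relabel (node l r) (left v)  s z           = relabel l v (node r s) (shiftˡ z)
relabel (node l r) (right v) s z           = relabel r v (node l s) (shiftʳ z)

unlabel : (t : BTree) (v : LeafPos t) (s : BTree) → CLeaf (hang t v s) → Pos t s
unlabel leaf       here      s nothing  = inj₁ here
unlabel leaf       here      s (just b) = inj₂ b
unlabel (node l r) (left v)  s w        = unshiftˡ (unlabel l v (node r s) w)
unlabel (node l r) (right v) s w        = unshiftʳ (unlabel r v (node l s) w)

unlabel-relabel : ∀ t v s z → unlabel t v s (relabel t v s z) ≡ z
unlabel-relabel leaf       here      s (inj₁ here) = refl
unlabel-relabel leaf       here      s (inj₂ b)    = refl
unlabel-relabel (node l r) (left v)  s z =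
  trans (cong unshiftˡ (unlabel-relabel l v (node r s) (shiftˡ z))) (unshiftˡ-shiftˡ z)
unlabel-relabel (node l r) (right v) s z =
  trans (cong unshiftʳ (unlabel-relabel r v (node l s) (shiftʳ z))) (unshiftʳ-shiftʳ z)

relabel-unlabel : ∀ t v s w → relabel t v s (unlabel t v s w) ≡ w
relabel-unlabel leaf       here      s nothing  = refl
relabel-unlabel leaf       here      s (just b) = refl
relabel-unlabel (node l r) (left v)  s w =
  trans (cong (relabel l v (node r s)) (shiftˡ-unshiftˡ _)) (relabel-unlabel l v (node r s) w)
relabel-unlabel (node l r) (right v) s w =
  trans (cong (relabel r v (node l s)) (shiftʳ-unshiftʳ _)) (relabel-unlabel r v (node l s) w)

unlabel-nothing : ∀ t v s → unlabel t v s nothing ≡ inj₁ v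
unlabel-nothing leaf       here      s = refl
unlabel-nothing (node l r) (left v)  s = cong unshiftˡ (unlabel-nothing l v (node r s))
unlabel-nothing (node l r) (right v) s = cong unshiftʳ (unlabel-nothing r v (node l s))

-- Every edge of hang t v s is an edge of t or of s, given by a vertex of one of them.
Edge : BTree → BTree → Set
Edge t s = NodePos t ⊎ NodePos s

separates : ∀ {t s} → Edge t s → Pos t s → Bool
separates (inj₁ p) (inj₁ a) = below a p
separates (inj₁ p) (inj₂ b) = false
separates (inj₂ q) (inj₁ a) = false
separates (inj₂ q) (inj₂ b) = below b q

-- The second component records whether the two sides of the edge are swapped.
edgeˡ : ∀ {l r s} → Edge l (node r s) → Edge (node l r) s × Bool
edgeˡ (inj₁ p)       = inj₁ (inl p) , false
edgeˡ (inj₂ here)    = inj₁ (inl here) , true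
edgeˡ (inj₂ (inl p)) = inj₁ (inr p) , false
edgeˡ (inj₂ (inr p)) = inj₂ p , false

edgeʳ : ∀ {l r s} → Edge r (node l s) → Edge (node l r) s × Bool
edgeʳ (inj₁ p)       = inj₁ (inr p) , false
edgeʳ (inj₂ here)    = inj₁ (inr here) , true
edgeʳ (inj₂ (inl p)) = inj₁ (inl p) , false
edgeʳ (inj₂ (inr p)) = inj₂ p , false

separates-shiftˡ : ∀ {l r s} (e : Edge l (node r s)) (z : Pos (node l r) s) →
  separates e (shiftˡ z) ≡ (proj₂ (edgeˡ e) xor separates (proj₁ (edgeˡ e)) z)
separates-shiftˡ (inj₁ p)       (inj₁ (left a))  = refl
separates-shiftˡ (inj₁ p)       (inj₁ (right a)) = refl
separates-shiftˡ (inj₁ p)       (inj₂ b)         = refl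
separates-shiftˡ (inj₂ here)    (inj₁ (left a))  = refl
separates-shiftˡ (inj₂ here)    (inj₁ (right a)) = refl
separates-shiftˡ (inj₂ here)    (inj₂ b)         = refl
separates-shiftˡ (inj₂ (inl p)) (inj₁ (left a))  = refl
separates-shiftˡ (inj₂ (inl p)) (inj₁ (right a)) = refl
separates-shiftˡ (inj₂ (inl p)) (inj₂ b)         = refl
separates-shiftˡ (inj₂ (inr p)) (inj₁ (left a))  = refl
separates-shiftˡ (inj₂ (inr p)) (inj₁ (right a)) = refl
separates-shiftˡ (inj₂ (inr p)) (inj₂ b)         = refl

separates-shiftʳ : ∀ {l r s} (e : Edge r (node l s)) (z : Pos (node l r) s) →
  separates e (shiftʳ z) ≡ (proj₂ (edgeʳ e) xor separates (proj₁ (edgeʳ e)) z)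
separates-shiftʳ (inj₁ p)       (inj₁ (left a))  = refl
separates-shiftʳ (inj₁ p)       (inj₁ (right a)) = refl
separates-shiftʳ (inj₁ p)       (inj₂ b)         = refl
separates-shiftʳ (inj₂ here)    (inj₁ (left a))  = refl
separates-shiftʳ (inj₂ here)    (inj₁ (right a)) = refl
separates-shiftʳ (inj₂ here)    (inj₂ b)         = refl
separates-shiftʳ (inj₂ (inl p)) (inj₁ (left a))  = refl
separates-shiftʳ (inj₂ (inl p)) (inj₁ (right a)) = refl
separates-shiftʳ (inj₂ (inl p)) (inj₂ b)         = refl
separates-shiftʳ (inj₂ (inr p)) (inj₁ (left a))  = refl
separates-shiftʳ (inj₂ (inr p)) (inj₁ (right a)) = refl
separates-shiftʳ (inj₂ (inr p)) (inj₂ b)         = refl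

hang-edge : ∀ t v s (q : NodePos (hang t v s)) →
  Σ (Edge t s) λ e → Σ Bool λ b → ∀ z → belowᶜ (relabel t v s z) q ≡ (b xor separates e z)
hang-edge leaf here s q = inj₂ q , false , λ { (inj₁ here) → refl ; (inj₂ b) → refl }
hang-edge (node l r) (left v) s q with hang-edge l v (node r s) q
... | e , b , sep = proj₁ (edgeˡ e) , (b xor proj₂ (edgeˡ e)) , λ z →
  trans (sep (shiftˡ z)) (trans (cong (b xor_) (separates-shiftˡ e z)) (sym (xor-assoc b _ _)))
hang-edge (node l r) (right v) s q with hang-edge r v (node l s) q
... | e , b , sep = proj₁ (edgeʳ e) , (b xor proj₂ (edgeʳ e)) , λ z →
  trans (sep (shiftʳ z)) (trans (cong (b xor_) (separates-shiftʳ e z)) (sym (xor-assoc b _ _)))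

module _ {t : BTree} (r : LeafPos t) where

  rerooted : BTree
  rerooted = hang t r leaf

  private
    toPos : CLeaf t → Pos t leaf
    toPos nothing  = inj₂ here
    toPos (just a) = inj₁ a

    fromPos : Pos t leaf → CLeaf t
    fromPos (inj₁ a)    = just a
    fromPos (inj₂ here) = nothing

    fromPos-toPos : ∀ v → fromPos (toPos v) ≡ v
    fromPos-toPos nothing  = refl
    fromPos-toPos (just a) = refl

    toPos-fromPos : ∀ z → toPos (fromPos z) ≡ z
    toPos-fromPos (inj₁ a)    = refl
    toPos-fromPos (inj₂ here) = refl

  reroot : CLeaf t → CLeaf rerooted
  reroot = relabel t r leaf ∘ toPos

  unreroot : CLeaf rerooted → CLeaf t
  unreroot = fromPos ∘ unlabel t r leaf

  reroot≡⇔ : ∀ {v w} → reroot v ≡ w ⇔ v ≡ unreroot w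
  reroot≡⇔ {v} {w} = mk⇔
    (λ { refl → sym (trans (cong fromPos (unlabel-relabel t r leaf (toPos v))) (fromPos-toPos v)) })
    (λ { refl → trans (cong (relabel t r leaf) (toPos-fromPos _)) (relabel-unlabel t r leaf w) })

  unreroot-nothing : unreroot nothing ≡ just r
  unreroot-nothing = cong fromPos (unlabel-nothing t r leaf)

  reroot-edge : ∀ q → Σ (NodePos t) λ p → Σ Bool λ b → ∀ v → belowᶜ (reroot v) q ≡ (b xor belowᶜ v p)
  reroot-edge q with hang-edge t r leaf q
  ... | inj₁ p , b , sep = p , b , λ v → trans (sep (toPos v)) (cong (b xor_) (old-vertex v))
    where
    old-vertex : ∀ v → separates (inj₁ p) (toPos v) ≡ belowᶜ v p
    old-vertex nothing  = refl
    old-vertex (just a) = refl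
  ... | inj₂ here , b , sep = here , not b , λ v →
    trans (sep (toPos v))
          (trans (cong (b xor_) (old-root v)) (trans (sym (not-distribʳ-xor b _)) (not-distribˡ-xor b _)))
    where
    old-root : ∀ v → separates (inj₂ here) (toPos v) ≡ not (belowᶜ v here)
    old-root nothing  = refl
    old-root (just a) = cong not (sym (below-here a))

module _ {n : ℕ} {t : BTree} (f : Fin n → CLeaf t) (r : LeafPos t) where

  side-reroot : ∀ q → Σ (NodePos t) λ p →
                side (reroot r ∘ f) q ≡ side f p ⊎ side (reroot r ∘ f) q ≡ ∁ (side f p)
  side-reroot q with reroot-edge r q
  ... | p , false , sep = p , inj₁ (tabulate-cong λ x → sep (f x))
  ... | p , true  , sep = p , inj₂ (trans (tabulate-cong λ x → sep (f x)) (tabulate-∘ not _))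

  fibre-reroot : ∀ w → fibre (reroot r ∘ f) w ≡ fibre f (unreroot r w)
  fibre-reroot w = ⊆-antisym
    (λ x∈ → Equivalence.from (∈-fibre f) (Equivalence.to (reroot≡⇔ r) (Equivalence.to (∈-fibre (reroot r ∘ f)) x∈)))
    (λ x∈ → Equivalence.from (∈-fibre (reroot r ∘ f)) (Equivalence.from (reroot≡⇔ r) (Equivalence.to (∈-fibre f) x∈)))

graft : ∀ {n T₁ T₂} → Subset n → (Fin n → CLeaf T₁) → (Fin n → CLeaf T₂) → Fin n → CLeaf (node T₁ T₂)
graft A f₁ f₂ x = if lookup A x then Maybe.map right (f₂ x) else Maybe.map left (f₁ x)

module _ {n T₁ T₂} (A : Subset n) (f₁ : Fin n → CLeaf T₁) (f₂ : Fin n → CLeaf T₂) where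

  side-graft-inl : ∀ p → side (graft A f₁ f₂) (inl p) ≡ side f₁ p ∩ ∁ A
  side-graft-inl p = subset-ext λ x → begin
    lookup (side (graft A f₁ f₂) (inl p)) x       ≡⟨ lookup∘tabulate _ x ⟩
    belowᶜ (graft A f₁ f₂ x) (inl p)              ≡⟨ lemma (lookup A x) (f₁ x) (f₂ x) ⟩
    belowᶜ (f₁ x) p ∧ not (lookup A x)            ≡⟨ cong₂ _∧_ (lookup∘tabulate _ x) (lookup-∁ A x) ⟨
    lookup (side f₁ p) x ∧ lookup (∁ A) x         ≡⟨ lookup-∩ (side f₁ p) (∁ A) x ⟨
    lookup (side f₁ p ∩ ∁ A) x                    ∎
    where
    open ≡-Reasoning
    lemma : ∀ a v w → belowᶜ (if a then Maybe.map right w else Maybe.map left v) (inl p) ≡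
                      (belowᶜ v p ∧ not a)
    lemma true  v        nothing  = sym (∧-zeroʳ (belowᶜ v p))
    lemma true  v        (just _) = sym (∧-zeroʳ (belowᶜ v p))
    lemma false nothing  _        = refl
    lemma false (just b) _        = sym (∧-identityʳ (below b p))

  side-graft-inr : ∀ p → side (graft A f₁ f₂) (inr p) ≡ side f₂ p ∩ A
  side-graft-inr p = subset-ext λ x → begin
    lookup (side (graft A f₁ f₂) (inr p)) x       ≡⟨ lookup∘tabulate _ x ⟩
    belowᶜ (graft A f₁ f₂ x) (inr p)              ≡⟨ lemma (lookup A x) (f₁ x) (f₂ x) ⟩
    belowᶜ (f₂ x) p ∧ lookup A x                  ≡⟨ cong (_∧ lookup A x) (lookup∘tabulate _ x) ⟨
    lookup (side f₂ p) x ∧ lookup A x             ≡⟨ lookup-∩ (side f₂ p) A x ⟨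
    lookup (side f₂ p ∩ A) x                      ∎
    where
    open ≡-Reasoning
    lemma : ∀ a v w → belowᶜ (if a then Maybe.map right w else Maybe.map left v) (inr p) ≡
                      (belowᶜ w p ∧ a)
    lemma true  _        nothing  = refl
    lemma true  _        (just b) = sym (∧-identityʳ (below b p))
    lemma false nothing  w        = sym (∧-zeroʳ (belowᶜ w p))
    lemma false (just _) w        = sym (∧-zeroʳ (belowᶜ w p))

  fibre-graft-left : ∀ a → fibre (graft A f₁ f₂) (just (left a)) ≡ fibre f₁ (just a) ∩ ∁ A
  fibre-graft-left a = begin
    fibre (graft A f₁ f₂) (just (left a))     ≡⟨ fibre-just (graft A f₁ f₂) (left a) ⟩
    side (graft A f₁ f₂) (inl (vertexOf a))   ≡⟨ side-graft-inl (vertexOf a) ⟩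
    side f₁ (vertexOf a) ∩ ∁ A                ≡⟨ cong (_∩ ∁ A) (fibre-just f₁ a) ⟨
    fibre f₁ (just a) ∩ ∁ A                   ∎
    where open ≡-Reasoning

  fibre-graft-right : ∀ a → fibre (graft A f₁ f₂) (just (right a)) ≡ fibre f₂ (just a) ∩ A
  fibre-graft-right a = begin
    fibre (graft A f₁ f₂) (just (right a))    ≡⟨ fibre-just (graft A f₁ f₂) (right a) ⟩
    side (graft A f₁ f₂) (inr (vertexOf a))   ≡⟨ side-graft-inr (vertexOf a) ⟩
    side f₂ (vertexOf a) ∩ A                  ≡⟨ cong (_∩ A) (fibre-just f₂ a) ⟨
    fibre f₂ (just a) ∩ A                     ∎
    where open ≡-Reasoning

  fibre-graft-root : fibre f₁ nothing ⊆ A → fibre f₂ nothing ⊆ ∁ A → fibre (graft A f₁ f₂) nothing ≡ ⊥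
  fibre-graft-root root₁⊆A root₂⊆∁A =
    ⊆-antisym (λ {x} x∈ → ⊥-elim (assigned x (Equivalence.to (∈-fibre (graft A f₁ f₂)) x∈))) (⊆-min _)
    where
    assigned : ∀ x → graft A f₁ f₂ x ≢ nothing
    assigned x root with lookup A x in x∈A | f₁ x in f₁x | f₂ x in f₂x
    assigned x ()   | true  | _       | just _
    assigned x ()   | false | just _  | _
    assigned x _    | true  | _       | nothing =
      x∈∁p⇒x∉p (root₂⊆∁A (Equivalence.from (∈-fibre f₂) f₂x)) (Equivalence.from ∈⇔lookup x∈A)
    assigned x _    | false | nothing | _ =
      contradiction (trans (sym x∈A) (Equivalence.to ∈⇔lookup (root₁⊆A (Equivalence.from (∈-fibre f₁) f₁x)))) λ ()

starLeaf : Bool → Bool → CLeaf (node leaf leaf)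
starLeaf true  _     = nothing
starLeaf false true  = just (left here)
starLeaf false false = just (right here)

star : ∀ {n} → Subset n → Subset n → Fin n → CLeaf (node leaf leaf)
star A B x = starLeaf (lookup A x) (lookup B x)

module _ {n : ℕ} where

  side-star-here : ∀ (A B : Subset n) → side (star A B) here ≡ ∁ A
  side-star-here A B = subset-ext λ x →
    trans (lookup∘tabulate _ x) (trans (lemma (lookup A x) (lookup B x)) (sym (lookup-∁ A x)))
    where
    lemma : ∀ a b → belowᶜ (starLeaf a b) here ≡ not a
    lemma true  _     = refl
    lemma false true  = refl
    lemma false false = refl

  side-star-inl : ∀ (A B : Subset n) → A ∩ B ≡ ⊥ → side (star A B) (inl here) ≡ B
  side-star-inl A B A∩B≡⊥ = subset-ext λ x →
    trans (lookup∘tabulate _ x) (lemma (lookup A x) (lookup B x) (lookup-disjoint A∩B≡⊥ x))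
    where
    lemma : ∀ a b → (a ∧ b) ≡ false → belowᶜ (starLeaf a b) (inl here) ≡ b
    lemma true  false _ = refl
    lemma false true  _ = refl
    lemma false false _ = refl

  side-star-inr : ∀ (A B C : Subset n) → A ∩ C ≡ ⊥ → B ∩ C ≡ ⊥ → A ∪ B ∪ C ≡ ⊤ →
                  side (star A B) (inr here) ≡ C
  side-star-inr A B C A∩C≡⊥ B∩C≡⊥ covers = subset-ext λ x → trans (lookup∘tabulate _ x)
    (lemma (lookup A x) (lookup B x) (lookup C x)
           (lookup-disjoint A∩C≡⊥ x) (lookup-disjoint B∩C≡⊥ x) (lookup-cover covers x))
    where
    lemma : ∀ a b c → (a ∧ c) ≡ false → (b ∧ c) ≡ false → (a ∨ b ∨ c) ≡ true →
            belowᶜ (starLeaf a b) (inr here) ≡ c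
    lemma true  _     false _ _ _ = refl
    lemma false true  false _ _ _ = refl
    lemma false false true  _ _ _ = refl

count : ∀ {n} {Q : Subset n → Set} → Decidable Q → ℕ
count {zero}  Q? = if does (Q? []) then 1 else 0
count {suc n} Q? = count (λ p → Q? (outside ∷ p)) + count (λ p → Q? (inside ∷ p))

count-mono : ∀ {n} {Q R : Subset n → Set} (Q? : Decidable Q) (R? : Decidable R) →
             (∀ {p} → Q p → R p) → count Q? ≤ count R?
count-mono {zero} Q? R? Q⇒R with Q? [] | R? []
... | no _  | _      = z≤n
... | yes _ | yes _  = ≤-refl
... | yes q | no ¬r  = ⊥-elim (¬r (Q⇒R q))
count-mono {suc n} Q? R? Q⇒R =
  +-mono-≤ (count-mono (λ p → Q? (outside ∷ p)) (λ p → R? (outside ∷ p)) Q⇒R)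
           (count-mono (λ p → Q? (inside ∷ p)) (λ p → R? (inside ∷ p)) Q⇒R)

count-< : ∀ {n} {Q R : Subset n → Set} (Q? : Decidable Q) (R? : Decidable R) →
          (∀ {p} → Q p → R p) → ∀ p → ¬ Q p → R p → count Q? < count R?
count-< {zero} Q? R? Q⇒R [] ¬q r with Q? [] | R? []
... | yes q | _     = ⊥-elim (¬q q)
... | no _  | yes _ = ≤-refl
... | no _  | no ¬r = ⊥-elim (¬r r)
count-< {suc n} Q? R? Q⇒R (outside ∷ p) ¬q r =
  +-mono-<-≤ (count-< (λ p → Q? (outside ∷ p)) (λ p → R? (outside ∷ p)) Q⇒R p ¬q r)
             (count-mono (λ p → Q? (inside ∷ p)) (λ p → R? (inside ∷ p)) Q⇒R)
count-< {suc n} Q? R? Q⇒R (inside ∷ p) ¬q r =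
  +-mono-≤-< (count-mono (λ p → Q? (outside ∷ p)) (λ p → R? (outside ∷ p)) Q⇒R)
             (count-< (λ p → Q? (inside ∷ p)) (λ p → R? (inside ∷ p)) Q⇒R p ¬q r)

minimal-witness : ∀ {n} {Q : Subset n → Set} → Decidable Q → (μ : Subset n → ℕ) →
                  ∃ Q → ∃ λ p → Q p × (∀ {q} → Q q → μ p ≤ μ q)
minimal-witness {Q = Q} Q? μ (p , Qp) = descend p Qp (<-wellFounded (μ p))
  where
  descend : ∀ p → Q p → Acc _<_ (μ p) → ∃ λ p → Q p × (∀ {q} → Q q → μ p ≤ μ q)
  descend p Qp (acc smaller) with anySubset? (λ q → Q? q ×-dec (μ q <? μ p))
  ... | yes (q , Qq , q<p) = descend q Qq (smaller q<p)
  ... | no  ¬below         = p , Qp , λ {q} Qq → ≮⇒≥ (λ q<p → ¬below (q , Qq , q<p))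

m+m≤n+n⇒m≤n : ∀ {m n} → m + m ≤ n + n → m ≤ n
m+m≤n+n⇒m≤n {m} {n} le = subst₂ _≤_ (sym (n≡⌊n+n/2⌋ m)) (sym (n≡⌊n+n/2⌋ n)) (⌊n/2⌋-mono le)

module Connectivity (K : ConnSys) where
  open ConnSys K

  conn-∁ : ∀ X → conn (∁ X) ≡ conn X
  conn-∁ X = sym (symm X)

  conn-⊥≤ : ∀ Y → conn ⊥ ≤ conn Y
  conn-⊥≤ Y = m+m≤n+n⇒m≤n (begin
    conn ⊥ + conn ⊥                ≡⟨ cong₂ _+_ (cong conn (sym (∩-inverseʳ Y))) conn-⊥≡conn-⊤ ⟩
    conn (Y ∩ ∁ Y) + conn (Y ∪ ∁ Y) ≤⟨ submod Y (∁ Y) ⟩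
    conn Y + conn (∁ Y)             ≡⟨ cong (conn Y +_) (conn-∁ Y) ⟩
    conn Y + conn Y                 ∎)
    where
    open ≤-Reasoning
    conn-⊥≡conn-⊤ : conn ⊥ ≡ conn (Y ∪ ∁ Y)
    conn-⊥≡conn-⊤ = trans (cong conn (sym (∁⊤≡⊥))) (trans (conn-∁ ⊤) (cong conn (sym (p∪∁p≡⊤ Y))))

  conn-posimodular : ∀ A B → conn (A ∩ ∁ B) + conn (B ∩ ∁ A) ≤ conn A + conn B
  conn-posimodular A B = begin
    conn (A ∩ ∁ B) + conn (B ∩ ∁ A)   ≡⟨ cong (λ Z → conn (A ∩ ∁ B) + conn Z) complement ⟨
    conn (A ∩ ∁ B) + conn (∁ (A ∪ ∁ B)) ≡⟨ cong (conn (A ∩ ∁ B) +_) (conn-∁ (A ∪ ∁ B)) ⟩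
    conn (A ∩ ∁ B) + conn (A ∪ ∁ B)   ≤⟨ submod A (∁ B) ⟩
    conn A + conn (∁ B)               ≡⟨ cong (conn A +_) (conn-∁ B) ⟩
    conn A + conn B                   ∎
    where
    open ≤-Reasoning
    complement : ∁ (A ∪ ∁ B) ≡ B ∩ ∁ A
    complement = trans (∁-∪ A (∁ B)) (trans (cong (∁ A ∩_) (∁-involutive B)) (∩-comm (∁ A) B))

  conn-∩∁≤ : ∀ C B → conn B ≤ conn (B ∩ ∁ C) → conn (C ∩ ∁ B) ≤ conn C
  conn-∩∁≤ C B le = +-cancelʳ-≤ (conn (B ∩ ∁ C)) (conn (C ∩ ∁ B)) (conn C)
    (≤-trans (conn-posimodular C B) (+-monoʳ-≤ (conn C) le))

  conn-fibre≤ : ∀ {t T} (f : Fin n → CLeaf T) → (∀ p → conn (side f p) ≤ t) → ∀ v → conn (fibre f v) ≤ t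
  conn-fibre≤ {t} f narrow nothing  =
    subst (_≤ t) (trans (sym (conn-∁ _)) (cong conn (sym (fibre-nothing f)))) (narrow here)
  conn-fibre≤ {t} f narrow (just a) = subst (_≤ t) (cong conn (sym (fibre-just f a))) (narrow (vertexOf a))

module Tangles (K : ConnSys) where
  open ConnSys K
  open Connectivity K

  module _ {k : ℕ} {𝒯 : Subset n → Set} (tangle : IsTangle K k 𝒯) where
    open IsTangle tangle

    tangle-⊆ : ∀ {F Y} → 𝒯 Y → F ⊆ Y → conn F < k → 𝒯 F
    tangle-⊆ {F} {Y} Y∈𝒯 F⊆Y F<k with oneOf F F<k
    ... | inj₁ F∈𝒯  = F∈𝒯
    ... | inj₂ ∁F∈𝒯 = ⊥-elim (noCover Y (∁ F) (∁ F) Y∈𝒯 ∁F∈𝒯 ∁F∈𝒯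
                        (trans (cong (Y ∪_) (∪-idem (∁ F))) (⊆⇒∪∁≡⊤ F⊆Y)))

    tangle-⁅⁆ : ∀ y → conn ⁅ y ⁆ < k → 𝒯 ⁅ y ⁆
    tangle-⁅⁆ y y<k with oneOf ⁅ y ⁆ y<k
    ... | inj₁ y∈𝒯  = y∈𝒯
    ... | inj₂ ∁y∈𝒯 = ⊥-elim (noBig (∁ ⁅ y ⁆) ∁y∈𝒯 (suc-∣∁⁅⁆∣ y))

    tangle-restrict : ∀ {t} → t ≤ k → IsTangle K t (λ Z → 𝒯 Z × conn Z < t)
    tangle-restrict t≤k = record
      { sub     = λ _ → proj₂
      ; oneOf   = λ A A<t → restrict-oneOf A<t (oneOf A (<-≤-trans A<t t≤k))
      ; notBoth = λ A A<t both → notBoth A (<-≤-trans A<t t≤k) (proj₁ (proj₁ both) , proj₁ (proj₂ both))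
      ; noCover = λ T₁ T₂ T₃ T₁∈ T₂∈ T₃∈ → noCover T₁ T₂ T₃ (proj₁ T₁∈) (proj₁ T₂∈) (proj₁ T₃∈)
      ; noBig   = λ Z Z∈ → noBig Z (proj₁ Z∈)
      }
      where
      restrict-oneOf : ∀ {t A} → conn A < t → 𝒯 A ⊎ 𝒯 (∁ A) →
                       (𝒯 A × conn A < t) ⊎ (𝒯 (∁ A) × conn (∁ A) < t)
      restrict-oneOf A<t (inj₁ A∈𝒯)  = inj₁ (A∈𝒯 , A<t)
      restrict-oneOf A<t (inj₂ ∁A∈𝒯) = inj₂ (∁A∈𝒯 , subst (_< _) (sym (conn-∁ _)) A<t)

    sides∈tangle : ∀ {T} (f : Fin n → CLeaf T) → (∀ p → conn (side f p) < k) →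
                   (∀ a → 𝒯 (fibre f (just a))) → ∀ p → 𝒯 (side f p)
    sides∈tangle {leaf} f _ leaves here = subst 𝒯 (fibre-just f here) (leaves here)
    sides∈tangle {node l r} f narrow leaves = sides
      where
      sidesˡ : ∀ p → 𝒯 (side f (inl p))
      sidesˡ p = subst 𝒯 (side-restrictˡ f p)
        (sides∈tangle (restrictˡ ∘ f)
          (λ q → subst (_< k) (cong conn (sym (side-restrictˡ f q))) (narrow (inl q)))
          (λ a → subst 𝒯 (sym (fibre-restrictˡ f a)) (leaves (left a))) p)
      sidesʳ : ∀ p → 𝒯 (side f (inr p))
      sidesʳ p = subst 𝒯 (side-restrictʳ f p)
        (sides∈tangle (restrictʳ ∘ f)
          (λ q → subst (_< k) (cong conn (sym (side-restrictʳ f q))) (narrow (inr q)))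
          (λ a → subst 𝒯 (sym (fibre-restrictʳ f a)) (leaves (right a))) p)
      covers : side f (inl here) ∪ side f (inr here) ∪ ∁ (side f here) ≡ ⊤
      covers = begin
        side f (inl here) ∪ side f (inr here) ∪ ∁ (side f here)   ≡⟨ ∪-assoc _ _ _ ⟨
        (side f (inl here) ∪ side f (inr here)) ∪ ∁ (side f here) ≡⟨ cong (_∪ ∁ (side f here)) (side-here-∪ f) ⟨
        side f here ∪ ∁ (side f here)                              ≡⟨ p∪∁p≡⊤ _ ⟩
        ⊤                                                          ∎
        where open ≡-Reasoning
      sides : ∀ p → 𝒯 (side f p)
      sides (inl p) = sidesˡ p
      sides (inr p) = sidesʳ p
      sides here with oneOf (side f here) (narrow here)
      ... | inj₁ S∈𝒯  = S∈𝒯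
      ... | inj₂ ∁S∈𝒯 = ⊥-elim (noCover _ _ _ (sidesˡ here) (sidesʳ here) ∁S∈𝒯 covers)

    tangle-blocks-decomposition : ∀ {T} (f : Fin n → CLeaf T) → (∀ p → conn (side f p) < k) →
                                  ¬ (∀ v → 𝒯 (fibre f v))
    tangle-blocks-decomposition f narrow leaves = notBoth (side f here) (narrow here)
      (sides∈tangle f narrow (leaves ∘ just) here , subst 𝒯 (fibre-nothing f) (leaves nothing))

    weakly-branched⇒∈tangle : ∀ {s X} → s < k → WeaklyBranched K s X → 𝒯 X
    weakly-branched⇒∈tangle {s} {X} s<k (X≤s , D , narrow , leaves) with oneOf X (≤-<-trans X≤s s<k)
    ... | inj₁ X∈𝒯  = X∈𝒯
    ... | inj₂ ∁X∈𝒯 = ⊥-elim (tangle-blocks-decomposition f (λ p → ≤-<-trans (narrow p) s<k) fibre∈𝒯)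
      where
      f : Fin n → CLeaf (PBD.tree D)
      f = PBD.f D
      fibre<k : ∀ v → conn (fibre f v) < k
      fibre<k v = ≤-<-trans (conn-fibre≤ f narrow v) s<k
      fibre∈𝒯 : ∀ v → 𝒯 (fibre f v)
      fibre∈𝒯 v with leaves v
      ... | inj₁ inside∁X        = tangle-⊆ ∁X∈𝒯 (Equivalence.from (fibre⊆⇔ f) inside∁X) (fibre<k v)
      ... | inj₂ (y , singleton) = subst 𝒯 (sym F≡y) (tangle-⁅⁆ y (subst (_< k) (cong conn F≡y) (fibre<k v)))
        where
        F≡y : fibre f v ≡ ⁅ y ⁆
        F≡y = Equivalence.from (fibre≡⁅⁆⇔ f) singleton

-- Tangles of order t + 1 versus decompositions of width t

module Duality (K : ConnSys) (t : ℕ) where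
  open ConnSys K
  open Connectivity K

  record IsDownset (𝒫 : Subset n → Set) : Set where
    field
      decide  : Decidable 𝒫
      bounded : ∀ {Z} → 𝒫 Z → conn Z ≤ t
      down    : ∀ {Z W} → 𝒫 Z → W ⊆ Z → conn W ≤ t → 𝒫 W
      has-⊥   : 𝒫 ⊥

  Admissible : (Subset n → Set) → Subset n → Set
  Admissible 𝒫 F = (∃ λ Y → 𝒫 Y × F ⊆ Y) ⊎ (∃ λ y → F ≡ ⁅ y ⁆)

  record Decomposition (𝒫 : Subset n → Set) : Set where
    field
      tree   : BTree
      assign : Fin n → CLeaf tree
      narrow : ∀ p → conn (side assign p) ≤ t
      leaves : ∀ v → Admissible 𝒫 (fibre assign v)

  TangleAbove : (Subset n → Set) → Set₁
  TangleAbove 𝒫 = ∃ λ 𝒯 → IsTangle K (suc t) 𝒯 × (∀ {Z} → 𝒫 Z → 𝒯 Z)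

  Undecided : (Subset n → Set) → Subset n → Set
  Undecided 𝒫 Z = conn Z ≤ t × ¬ 𝒫 Z × ¬ 𝒫 (∁ Z)

  undecided? : ∀ {𝒫} → IsDownset 𝒫 → Decidable (Undecided 𝒫)
  undecided? downset Z = (conn Z ≤? t) ×-dec ¬? (decide Z) ×-dec ¬? (decide (∁ Z))
    where open IsDownset downset

  extend : (Subset n → Set) → Subset n → Subset n → Set
  extend 𝒫 B Z = 𝒫 Z ⊎ (Z ⊆ B × conn Z ≤ t)

  record MinimalUndecided (𝒫 : Subset n → Set) (A : Subset n) : Set where
    field
      undecided : Undecided 𝒫 A
      minimal   : ∀ {Z} → Undecided 𝒫 Z → conn A ≤ conn Z

  minimal-undecided-∁ : ∀ {𝒫 A} → MinimalUndecided 𝒫 A → MinimalUndecided 𝒫 (∁ A)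
  minimal-undecided-∁ {𝒫} {A} record { undecided = A≤t , A∉𝒫 , ∁A∉𝒫 ; minimal = minimal } = record
    { undecided = subst (_≤ t) (sym (conn-∁ A)) A≤t , ∁A∉𝒫 , subst (λ Z → ¬ 𝒫 Z) (sym (∁-involutive A)) A∉𝒫
    ; minimal   = λ {Z} u → subst (_≤ conn Z) (sym (conn-∁ A)) (minimal u)
    }

  minimal-undecided-≤ : ∀ {𝒫 A Z} → MinimalUndecided 𝒫 A → ¬ 𝒫 Z → ¬ 𝒫 (∁ Z) → conn A ≤ conn Z
  minimal-undecided-≤ {Z = Z} m Z∉𝒫 ∁Z∉𝒫 with conn Z ≤? t
  ... | yes Z≤t = MinimalUndecided.minimal m (Z≤t , Z∉𝒫 , ∁Z∉𝒫)
  ... | no  Z≰t = ≤-trans (proj₁ (MinimalUndecided.undecided m)) (<⇒≤ (≰⇒> Z≰t))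

  reroot-decomposition : ∀ {𝒬} (D : Decomposition 𝒬) (v : CLeaf (Decomposition.tree D)) →
    Σ (Decomposition 𝒬) λ D′ → fibre (Decomposition.assign D′) nothing ≡ fibre (Decomposition.assign D) v
  reroot-decomposition D nothing  = D , refl
  reroot-decomposition {𝒬} D (just r) =
    D′ , trans (fibre-reroot assign r nothing) (cong (fibre assign) (unreroot-nothing r))
    where
    open Decomposition D
    narrow′ : ∀ q → conn (side (reroot r ∘ assign) q) ≤ t
    narrow′ q with side-reroot assign r q
    ... | p , inj₁ same    = subst (_≤ t) (cong conn (sym same)) (narrow p)
    ... | p , inj₂ swapped = subst (_≤ t) (trans (sym (conn-∁ _)) (cong conn (sym swapped))) (narrow p)
    D′ : Decomposition 𝒬
    D′ = record
      { tree   = rerooted r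
      ; assign = reroot r ∘ assign
      ; narrow = narrow′
      ; leaves = λ w → subst (Admissible 𝒬) (sym (fibre-reroot assign r w)) (leaves (unreroot r w))
      }

  record BadRooted (𝒫 : Subset n → Set) (B : Subset n) : Set where
    field
      decomposition : Decomposition (extend 𝒫 B)
      root⊆B        : fibre (Decomposition.assign decomposition) nothing ⊆ B
      root∉𝒫        : ¬ 𝒫 (fibre (Decomposition.assign decomposition) nothing)

  module _ {𝒫 : Subset n → Set} (downset : IsDownset 𝒫) where
    open IsDownset downset

    leaf-decomposition : ∀ {A} → 𝒫 A → Admissible 𝒫 (∁ A) → Decomposition 𝒫
    leaf-decomposition {A} A∈𝒫 ∁A-admissible = record
      { tree = leaf ; assign = assign ; narrow = narrow ; leaves = leaves }
      where
      pick : Bool → CLeaf leaf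
      pick true  = just here
      pick false = nothing
      assign : Fin n → CLeaf leaf
      assign x = pick (lookup A x)
      side≡A : side assign here ≡ A
      side≡A = subset-ext λ x → trans (lookup∘tabulate _ x) (lemma (lookup A x))
        where
        lemma : ∀ b → belowᶜ (pick b) here ≡ b
        lemma true  = refl
        lemma false = refl
      narrow : ∀ p → conn (side assign p) ≤ t
      narrow here = subst (λ Z → conn Z ≤ t) (sym side≡A) (bounded A∈𝒫)
      leaves : ∀ v → Admissible 𝒫 (fibre assign v)
      leaves nothing     = subst (Admissible 𝒫) (sym (trans (fibre-nothing assign) (cong ∁ side≡A))) ∁A-admissible
      leaves (just here) = inj₁ (A , A∈𝒫 , ⊆-reflexive (trans (fibre-just assign here) side≡A))

    star-decomposition : ∀ {A B C} → 𝒫 A → 𝒫 B → 𝒫 C →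
      A ∩ B ≡ ⊥ → A ∩ C ≡ ⊥ → B ∩ C ≡ ⊥ → A ∪ B ∪ C ≡ ⊤ → Decomposition 𝒫
    star-decomposition {A} {B} {C} A∈𝒫 B∈𝒫 C∈𝒫 A∩B≡⊥ A∩C≡⊥ B∩C≡⊥ covers = record
      { tree = node leaf leaf ; assign = star A B ; narrow = narrow ; leaves = leaves }
      where
      narrow : ∀ p → conn (side (star A B) p) ≤ t
      narrow here       = subst (_≤ t) (trans (sym (conn-∁ A)) (cong conn (sym (side-star-here A B)))) (bounded A∈𝒫)
      narrow (inl here) = subst (_≤ t) (cong conn (sym (side-star-inl A B A∩B≡⊥))) (bounded B∈𝒫)
      narrow (inr here) = subst (_≤ t) (cong conn (sym (side-star-inr A B C A∩C≡⊥ B∩C≡⊥ covers))) (bounded C∈𝒫)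
      leaves : ∀ v → Admissible 𝒫 (fibre (star A B) v)
      leaves nothing             = inj₁ (A , A∈𝒫 , ⊆-reflexive
        (trans (fibre-nothing (star A B)) (trans (cong ∁ (side-star-here A B)) (∁-involutive A))))
      leaves (just (left here))  = inj₁ (B , B∈𝒫 , ⊆-reflexive
        (trans (fibre-just (star A B) (left here)) (side-star-inl A B A∩B≡⊥)))
      leaves (just (right here)) = inj₁ (C , C∈𝒫 , ⊆-reflexive
        (trans (fibre-just (star A B) (right here)) (side-star-inr A B C A∩C≡⊥ B∩C≡⊥ covers)))

    record DisjointRefinement (A B : Subset n) : Set where
      field
        A′ B′     : Subset n
        A′∈𝒫      : 𝒫 A′
        B′∈𝒫      : 𝒫 B′
        A′⊆A      : A′ ⊆ A
        B′⊆B      : B′ ⊆ B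
        disjoint  : A′ ∩ B′ ≡ ⊥
        union     : A′ ∪ B′ ≡ A ∪ B

    refine-∖ : ∀ {A B} → 𝒫 A → 𝒫 B → conn (A ∩ ∁ B) ≤ t → DisjointRefinement A B
    refine-∖ {A} {B} A∈𝒫 B∈𝒫 A∖B≤t = record
      { A′ = A ∩ ∁ B ; B′ = B
      ; A′∈𝒫 = down A∈𝒫 (p∩q⊆p A (∁ B)) A∖B≤t ; B′∈𝒫 = B∈𝒫
      ; A′⊆A = p∩q⊆p A (∁ B) ; B′⊆B = λ x∈ → x∈
      ; disjoint = begin
          (A ∩ ∁ B) ∩ B ≡⟨ ∩-assoc A (∁ B) B ⟩
          A ∩ (∁ B ∩ B) ≡⟨ cong (A ∩_) (∩-inverseˡ B) ⟩
          A ∩ ⊥         ≡⟨ ∩-zeroʳ A ⟩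
          ⊥             ∎
      ; union = begin
          (A ∩ ∁ B) ∪ B       ≡⟨ ∪-distribʳ-∩ B A (∁ B) ⟩
          (A ∪ B) ∩ (∁ B ∪ B) ≡⟨ cong ((A ∪ B) ∩_) (∪-inverseˡ B) ⟩
          (A ∪ B) ∩ ⊤         ≡⟨ ∩-identityʳ (A ∪ B) ⟩
          A ∪ B               ∎
      }
      where open ≡-Reasoning

    refinement-swap : ∀ {A B} → DisjointRefinement B A → DisjointRefinement A B
    refinement-swap {A} {B} r = record
      { A′ = B′ ; B′ = A′ ; A′∈𝒫 = B′∈𝒫 ; B′∈𝒫 = A′∈𝒫 ; A′⊆A = B′⊆B ; B′⊆B = A′⊆A
      ; disjoint = trans (∩-comm B′ A′) disjoint
      ; union = trans (∪-comm B′ A′) (trans union (∪-comm B A))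
      }
      where open DisjointRefinement r

    -- By posimodularity A ∖ B or B ∖ A has order at most t.
    refine : ∀ {A B} → 𝒫 A → 𝒫 B → DisjointRefinement A B
    refine {A} {B} A∈𝒫 B∈𝒫 with conn (A ∩ ∁ B) ≤? t
    ... | yes A∖B≤t = refine-∖ A∈𝒫 B∈𝒫 A∖B≤t
    ... | no  A∖B≰t = refinement-swap (refine-∖ B∈𝒫 A∈𝒫 B∖A≤t)
      where
      B∖A≤t : conn (B ∩ ∁ A) ≤ t
      B∖A≤t with conn (B ∩ ∁ A) ≤? t
      ... | yes ≤t = ≤t
      ... | no  ≰t = ⊥-elim (<⇒≱ (+-mono-< (≰⇒> A∖B≰t) (≰⇒> ≰t))
                       (≤-trans (conn-posimodular A B) (+-mono-≤ (bounded A∈𝒫) (bounded B∈𝒫))))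

    cover-decomposition : ∀ {T₁ T₂ T₃} → 𝒫 T₁ → 𝒫 T₂ → 𝒫 T₃ → T₁ ∪ T₂ ∪ T₃ ≡ ⊤ → Decomposition 𝒫
    cover-decomposition {T₁} {T₂} {T₃} T₁∈𝒫 T₂∈𝒫 T₃∈𝒫 covers =
      star-decomposition (A′∈𝒫 r₂) (A′∈𝒫 r₃) (B′∈𝒫 r₃)
        (∩≡⊥-⊆ (disjoint r₁) (A′⊆A r₂) (A′⊆A r₃))
        (∩≡⊥-⊆ (disjoint r₂) (λ x∈ → x∈) (B′⊆B r₃))
        (disjoint r₃)
        covers′
      where
      open DisjointRefinement
      r₁ : DisjointRefinement T₁ T₂
      r₁ = refine T₁∈𝒫 T₂∈𝒫
      r₂ : DisjointRefinement (A′ r₁) T₃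
      r₂ = refine (A′∈𝒫 r₁) T₃∈𝒫
      r₃ : DisjointRefinement (B′ r₁) (B′ r₂)
      r₃ = refine (B′∈𝒫 r₁) (B′∈𝒫 r₂)
      covers′ : A′ r₂ ∪ A′ r₃ ∪ B′ r₃ ≡ ⊤
      covers′ = begin
        A′ r₂ ∪ (A′ r₃ ∪ B′ r₃)   ≡⟨ cong (A′ r₂ ∪_) (union r₃) ⟩
        A′ r₂ ∪ (B′ r₁ ∪ B′ r₂)   ≡⟨ ∪-∪-swap (A′ r₂) (B′ r₁) (B′ r₂) ⟩
        B′ r₁ ∪ (A′ r₂ ∪ B′ r₂)   ≡⟨ cong (B′ r₁ ∪_) (union r₂) ⟩
        B′ r₁ ∪ (A′ r₁ ∪ T₃)      ≡⟨ ∪-assoc (B′ r₁) (A′ r₁) T₃ ⟨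
        (B′ r₁ ∪ A′ r₁) ∪ T₃      ≡⟨ cong (_∪ T₃) (trans (∪-comm (B′ r₁) (A′ r₁)) (union r₁)) ⟩
        (T₁ ∪ T₂) ∪ T₃            ≡⟨ ∪-assoc T₁ T₂ T₃ ⟩
        T₁ ∪ T₂ ∪ T₃              ≡⟨ covers ⟩
        ⊤                         ∎
        where
        open ≡-Reasoning
        ∪-∪-swap : ∀ p q r → p ∪ (q ∪ r) ≡ q ∪ (p ∪ r)
        ∪-∪-swap p q r = trans (sym (∪-assoc p q r)) (trans (cong (_∪ r) (∪-comm p q)) (∪-assoc q p r))


    -- Without undecided sets 𝒫 is itself a tangle unless one of its axioms fails,
    -- and each failure is witnessed by a small decomposition.
    all-decided⇒TangleAbove⊎Decomposition : (∀ Z → ¬ Undecided 𝒫 Z) → TangleAbove 𝒫 ⊎ Decomposition 𝒫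
    all-decided⇒TangleAbove⊎Decomposition decided
      with anySubset? (λ A → decide A ×-dec decide (∁ A))
    ... | yes (A , A∈𝒫 , ∁A∈𝒫) = inj₂ (leaf-decomposition A∈𝒫 (inj₁ (∁ A , ∁A∈𝒫 , λ x∈ → x∈)))
    ... | no ¬complementary
      with anySubset? (λ A → decide A ×-dec (suc ∣ A ∣ ≟ n))
    ... | yes (A , A∈𝒫 , big) = inj₂ (leaf-decomposition A∈𝒫 (inj₂ (suc∣p∣≡n⇒∁p≡⁅x⁆ A big)))
    ... | no ¬big
      with anySubset? (λ T₁ → anySubset? (λ T₂ → anySubset? (λ T₃ →
             decide T₁ ×-dec decide T₂ ×-dec decide T₃ ×-dec (T₁ ∪ T₂ ∪ T₃ ≟ˢ ⊤))))
    ... | yes (T₁ , T₂ , T₃ , T₁∈𝒫 , T₂∈𝒫 , T₃∈𝒫 , covers) =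
            inj₂ (cover-decomposition T₁∈𝒫 T₂∈𝒫 T₃∈𝒫 covers)
    ... | no ¬cover = inj₁ (𝒫 , tangle , λ Z∈𝒫 → Z∈𝒫)
      where
      oneOf : ∀ A → conn A < suc t → 𝒫 A ⊎ 𝒫 (∁ A)
      oneOf A A≤t with decide A | decide (∁ A)
      ... | yes A∈𝒫 | _          = inj₁ A∈𝒫
      ... | no _    | yes ∁A∈𝒫   = inj₂ ∁A∈𝒫
      ... | no A∉𝒫  | no ∁A∉𝒫   = ⊥-elim (decided A (≤-pred A≤t , A∉𝒫 , ∁A∉𝒫))
      tangle : IsTangle K (suc t) 𝒫
      tangle = record
        { sub     = λ _ Z∈𝒫 → s≤s (bounded Z∈𝒫)
        ; oneOf   = oneOf
        ; notBoth = λ A _ both → ¬complementary (A , both)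
        ; noCover = λ T₁ T₂ T₃ T₁∈𝒫 T₂∈𝒫 T₃∈𝒫 covers → ¬cover (T₁ , T₂ , T₃ , T₁∈𝒫 , T₂∈𝒫 , T₃∈𝒫 , covers)
        ; noBig   = λ X X∈𝒫 big → ¬big (X , X∈𝒫 , big)
        }


    extend-downset : ∀ B → IsDownset (extend 𝒫 B)
    extend-downset B = record
      { decide  = λ Z → decide Z ⊎-dec ((Z ⊆? B) ×-dec (conn Z ≤? t))
      ; bounded = λ { (inj₁ Z∈𝒫) → bounded Z∈𝒫 ; (inj₂ (_ , Z≤t)) → Z≤t }
      ; down    = λ { (inj₁ Z∈𝒫) W⊆Z W≤t → inj₁ (down Z∈𝒫 W⊆Z W≤t)
                    ; (inj₂ (Z⊆B , _)) W⊆Z W≤t → inj₂ (⊆-trans W⊆Z Z⊆B , W≤t) }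
      ; has-⊥   = inj₁ has-⊥
      }

    -- Extending by A or by ∁ A decides A and no new set becomes undecided.
    count-undecided-extend : ∀ {A B} → Undecided 𝒫 A → A ⊆ B ⊎ ∁ A ⊆ B →
      count (undecided? (extend-downset B)) < count (undecided? downset)
    count-undecided-extend {A} {B} undecidedA A-or-∁A⊆B =
      count-< (undecided? (extend-downset B)) (undecided? downset)
        (λ (Z≤t , Z∉ , ∁Z∉) → Z≤t , Z∉ ∘ inj₁ , ∁Z∉ ∘ inj₁) A (decided A-or-∁A⊆B) undecidedA
      where
      A≤t : conn A ≤ t
      A≤t = proj₁ undecidedA
      decided : A ⊆ B ⊎ ∁ A ⊆ B → ¬ Undecided (extend 𝒫 B) A
      decided (inj₁ A⊆B)  (_ , A∉ , _)  = A∉ (inj₂ (A⊆B , A≤t))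
      decided (inj₂ ∁A⊆B) (_ , _ , ∁A∉) = ∁A∉ (inj₂ (∁A⊆B , subst (_≤ t) (sym (conn-∁ A)) A≤t))

    admissible-extend : ∀ {B F} → Admissible (extend 𝒫 B) F → Admissible 𝒫 F ⊎ (F ⊆ B × ¬ 𝒫 F)
    admissible-extend (inj₂ singleton)                 = inj₁ (inj₂ singleton)
    admissible-extend (inj₁ (Y , inj₁ Y∈𝒫 , F⊆Y))      = inj₁ (inj₁ (Y , Y∈𝒫 , F⊆Y))
    admissible-extend {F = F} (inj₁ (Y , inj₂ (Y⊆B , _) , F⊆Y)) with decide F
    ... | yes F∈𝒫 = inj₁ (inj₁ (F , F∈𝒫 , λ x∈ → x∈))
    ... | no  F∉𝒫 = inj₂ (⊆-trans F⊆Y Y⊆B , F∉𝒫)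

    admissible-∩ : ∀ {B C F} → (∀ {x} → x ∈ C → x ∉ B) → Admissible (extend 𝒫 B) F → Admissible 𝒫 (F ∩ C)
    admissible-∩ {B} {C} {F} C∌B (inj₁ (Y , inj₁ Y∈𝒫 , F⊆Y)) = inj₁ (Y , Y∈𝒫 , ⊆-trans (p∩q⊆p F C) F⊆Y)
    admissible-∩ {B} {C} {F} C∌B (inj₁ (Y , inj₂ (Y⊆B , _) , F⊆Y)) = inj₁ (⊥ , has-⊥ , λ x∈ →
      let (x∈F , x∈C) = x∈p∩q⁻ F C x∈ in ⊥-elim (C∌B x∈C (Y⊆B (F⊆Y x∈F))))
    admissible-∩ {B} {C} {F} C∌B (inj₂ (y , refl)) with y ∈? C
    ... | yes y∈C = inj₂ (y , ⊆-antisym (p∩q⊆p ⁅ y ⁆ C)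
                      (λ x∈y → x∈p∩q⁺ (x∈y , subst (_∈ C) (sym (x∈⁅y⁆⇒x≡y y x∈y)) y∈C)))
    ... | no  y∉C = inj₁ (⊥ , has-⊥ , λ x∈ →
      let (x∈y , x∈C) = x∈p∩q⁻ ⁅ y ⁆ C x∈ in ⊥-elim (y∉C (subst (_∈ C) (x∈⁅y⁆⇒x≡y y x∈y) x∈C)))

    improve-or-bad-root : ∀ {B} → Decomposition (extend 𝒫 B) → Decomposition 𝒫 ⊎ BadRooted 𝒫 B
    improve-or-bad-root {B} D with all-or-counterexample (λ v → admissible-extend (Decomposition.leaves D v))
    ... | inj₁ good = inj₁ record
      { tree = Decomposition.tree D ; assign = Decomposition.assign D
      ; narrow = Decomposition.narrow D ; leaves = good }
    ... | inj₂ (v , F⊆B , F∉𝒫) with reroot-decomposition D v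
    ... | D′ , root≡F = inj₂ record
      { decomposition = D′
      ; root⊆B        = subst (_⊆ B) (sym root≡F) F⊆B
      ; root∉𝒫        = F∉𝒫 ∘ subst 𝒫 root≡F
      }

    -- Cutting a side C of the bad-rooted decomposition down to C ∖ B costs nothing:
    -- B ∩ ∁ C contains the bad root fibre, so it is undecided and at least as connected as B.
    conn-∩∁-bad-root : ∀ {B C R} → MinimalUndecided 𝒫 B → R ⊆ B → R ⊆ ∁ C → ¬ 𝒫 R → conn R ≤ t →
                       conn (C ∩ ∁ B) ≤ conn C
    conn-∩∁-bad-root {B} {C} {R} minimalB R⊆B R⊆∁C R∉𝒫 R≤t =
      conn-∩∁≤ C B (minimal-undecided-≤ minimalB Z∉𝒫 ∁Z∉𝒫)
      where
      open MinimalUndecided minimalB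
      Z : Subset n
      Z = B ∩ ∁ C
      Z∉𝒫 : ¬ 𝒫 Z
      Z∉𝒫 Z∈𝒫 = R∉𝒫 (down Z∈𝒫 (λ x∈R → x∈p∩q⁺ (R⊆B x∈R , R⊆∁C x∈R)) R≤t)
      ∁Z∉𝒫 : ¬ 𝒫 (∁ Z)
      ∁Z∉𝒫 ∁Z∈𝒫 = proj₂ (proj₂ undecided)
        (down ∁Z∈𝒫 (p⊆q⇒∁p⊇∁q (p∩q⊆p B (∁ C))) (subst (_≤ t) (sym (conn-∁ B)) (proj₁ undecided)))

    glue : ∀ {A} → MinimalUndecided 𝒫 A → BadRooted 𝒫 A → BadRooted 𝒫 (∁ A) → Decomposition 𝒫
    glue {A} minimalA bad₁ bad₂ = record
      { tree = node D₁.tree D₂.tree ; assign = assign ; narrow = narrow′ ; leaves = leaves′ }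
      where
      module B₁ = BadRooted bad₁
      module B₂ = BadRooted bad₂
      module D₁ = Decomposition B₁.decomposition
      module D₂ = Decomposition B₂.decomposition
      assign : Fin n → CLeaf (node D₁.tree D₂.tree)
      assign = graft A D₁.assign D₂.assign
      root≡⊥ : fibre assign nothing ≡ ⊥
      root≡⊥ = fibre-graft-root A D₁.assign D₂.assign B₁.root⊆B B₂.root⊆B
      narrow′ : ∀ p → conn (side assign p) ≤ t
      narrow′ here = subst (_≤ t) (begin
          conn ⊥                              ≡⟨ cong conn root≡⊥ ⟨
          conn (fibre assign nothing)         ≡⟨ cong conn (fibre-nothing assign) ⟩
          conn (∁ (side assign here))         ≡⟨ conn-∁ _ ⟩
          conn (side assign here)             ∎) (bounded has-⊥)
        where open ≡-Reasoning
      narrow′ (inl p) = subst (_≤ t) (cong conn (sym (side-graft-inl A D₁.assign D₂.assign p)))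
        (≤-trans (conn-∩∁-bad-root minimalA B₁.root⊆B (fibre-nothing⊆∁side D₁.assign p) B₁.root∉𝒫
                   (conn-fibre≤ D₁.assign D₁.narrow nothing))
                 (D₁.narrow p))
      narrow′ (inr p) = subst (_≤ t)
        (cong conn (sym (trans (side-graft-inr A D₁.assign D₂.assign p)
                               (cong (side D₂.assign p ∩_) (sym (∁-involutive A))))))
        (≤-trans (conn-∩∁-bad-root (minimal-undecided-∁ minimalA) B₂.root⊆B
                   (fibre-nothing⊆∁side D₂.assign p) B₂.root∉𝒫
                   (conn-fibre≤ D₂.assign D₂.narrow nothing))
                 (D₂.narrow p))
      leaves′ : ∀ v → Admissible 𝒫 (fibre assign v)
      leaves′ nothing          = inj₁ (⊥ , has-⊥ , ⊆-reflexive root≡⊥)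
      leaves′ (just (left a))  = subst (Admissible 𝒫) (sym (fibre-graft-left A D₁.assign D₂.assign a))
        (admissible-∩ x∈∁p⇒x∉p (D₁.leaves (just a)))
      leaves′ (just (right a)) = subst (Admissible 𝒫) (sym (fibre-graft-right A D₁.assign D₂.assign a))
        (admissible-∩ (λ x∈A x∈∁A → x∈∁p⇒x∉p x∈∁A x∈A) (D₂.leaves (just a)))

  tangle-or-decomposition : ∀ {𝒫} (downset : IsDownset 𝒫) → Acc _<_ (count (undecided? downset)) →
                            TangleAbove 𝒫 ⊎ Decomposition 𝒫
  tangle-or-decomposition {𝒫} downset (acc smaller) with anySubset? (undecided? downset)
  ... | no none = all-decided⇒TangleAbove⊎Decomposition downset (λ Z u → none (Z , u))
  ... | yes some with minimal-witness (undecided? downset) conn some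
  ... | A , undecidedA , minimalA = combine (extended A (inj₁ (λ x∈ → x∈))) (extended (∁ A) (inj₂ (λ x∈ → x∈)))
    where
    minimal : MinimalUndecided 𝒫 A
    minimal = record { undecided = undecidedA ; minimal = minimalA }
    extended : ∀ B → A ⊆ B ⊎ ∁ A ⊆ B → TangleAbove 𝒫 ⊎ Decomposition (extend 𝒫 B)
    extended B A-or-∁A⊆B with tangle-or-decomposition (extend-downset downset B)
                                (smaller (count-undecided-extend downset undecidedA A-or-∁A⊆B))
    ... | inj₁ (𝒯 , tangle , above) = inj₁ (𝒯 , tangle , above ∘ inj₁)
    ... | inj₂ D                    = inj₂ D
    combine : TangleAbove 𝒫 ⊎ Decomposition (extend 𝒫 A) → TangleAbove 𝒫 ⊎ Decomposition (extend 𝒫 (∁ A)) →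
              TangleAbove 𝒫 ⊎ Decomposition 𝒫
    combine (inj₁ tangle) _ = inj₁ tangle
    combine (inj₂ _) (inj₁ tangle) = inj₁ tangle
    combine (inj₂ D₁) (inj₂ D₂) with improve-or-bad-root downset D₁ | improve-or-bad-root downset D₂
    ... | inj₁ D    | _         = inj₂ D
    ... | inj₂ _    | inj₁ D    = inj₂ D
    ... | inj₂ bad₁ | inj₂ bad₂ = inj₂ (glue downset minimal bad₁ bad₂)

  duality : ∀ {𝒫} → IsDownset 𝒫 → TangleAbove 𝒫 ⊎ Decomposition 𝒫
  duality downset = tangle-or-decomposition downset (<-wellFounded _)

module _ (K : ConnSys) where
  open ConnSys K
  open Connectivity K
  open Tangles K

  sets-inside-downset : ∀ X → Duality.IsDownset K (conn X) (λ Z → Z ⊆ ∁ X × conn Z ≤ conn X)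
  sets-inside-downset X = record
    { decide  = λ Z → (Z ⊆? ∁ X) ×-dec (conn Z ≤? conn X)
    ; bounded = proj₂
    ; down    = λ (Z⊆∁X , _) W⊆Z W≤X → ⊆-trans W⊆Z Z⊆∁X , W≤X
    ; has-⊥   = (λ x∈⊥ → ⊥-elim (∉⊥ x∈⊥)) , conn-⊥≤ X
    }

  ∈tangle⇒weakly-branched : ∀ {k 𝒯 X} → Entangled K k → IsTangle K k 𝒯 → conn X < k → 𝒯 X →
                            WeaklyBranched K (conn X) X
  ∈tangle⇒weakly-branched {𝒯 = 𝒯} {X} entangled tangle X<k X∈𝒯
    with Duality.duality K (conn X) (sets-inside-downset X)
  ... | inj₁ (𝒯′ , tangle′ , above) = ⊥-elim (IsTangle.notBoth tangle X X<k (X∈𝒯 , proj₁ ∁X∈𝒯ₜ))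
    where
    ∁X∈𝒯ₜ : 𝒯 (∁ X) × conn (∁ X) < suc (conn X)
    ∁X∈𝒯ₜ = Equivalence.from (entangled (suc (conn X)) X<k _ 𝒯′ (tangle-restrict tangle X<k) tangle′ (∁ X))
              (above ((λ x∈ → x∈) , ≤-reflexive (conn-∁ X)))
  ... | inj₂ D = ≤-refl , record { tree = tree ; f = assign } , narrow , displays
    where
    open Duality.Decomposition D
    displays : ∀ v → (∀ x → assign x ≡ v → x ∈ ∁ X) ⊎ (∃ λ y → ∀ x → (assign x ≡ v) ⇔ (x ≡ y))
    displays v with leaves v
    ... | inj₁ (Y , (Y⊆∁X , _) , F⊆Y) = inj₁ (Equivalence.to (fibre⊆⇔ assign) (⊆-trans F⊆Y Y⊆∁X))
    ... | inj₂ (y , F≡y)              = inj₂ (y , Equivalence.to (fibre≡⁅⁆⇔ assign) F≡y)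

lemma5p3 : (K : ConnSys) (k : ℕ) → Entangled K k →
    (𝒯 : Subset (ConnSys.n K) → Set) → IsTangle K k 𝒯 →
    (X : Subset (ConnSys.n K)) → InS K k X →
    WeaklyBranched K (ConnSys.conn K X) X ⇔ 𝒯 X
lemma5p3 K k entangled 𝒯 tangle X X<k =
  mk⇔ (Tangles.weakly-branched⇒∈tangle K tangle X<k) (∈tangle⇒weakly-branched K entangled tangle X<k)
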